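{- Let $F$ be the morphism on $\{\mathtt{0},\mathtt{1},\mathtt{2},\mathtt{3},\mathtt{4}\}^*$ given by $F(\mathtt{0})=\mathtt{01}$, $F(\mathtt{1})=\mathtt{2}$, $F(\mathtt{2})=\mathtt{03}$, $F(\mathtt{3})=\mathtt{24}$, $F(\mathtt{4})=\mathtt{23}$, and let $f=F^3$. Let $u$ be a word of length at least $2$ such that every conjugate of $u$ is a factor of the infinite word $F^\omega(\mathtt{0})$. Then $u$ is a conjugate of one of the words in $C=\{F(\mathtt{2}),F^2(\mathtt{2})\}\cup\{F^d(\mathtt{4}) : d\ge 1\}\cup\{f^d(\mathtt{0}) : d\ge 1\}$.
   Context: $F^\omega(\mathtt{0})$ is the infinite fixed point of $F$ beginning with $\mathtt{0}$. A conjugate of a word $xy$ is $yx$. Explicitly $f(\mathtt{0})=\mathtt{01203}$, $f(\mathtt{1})=\mathtt{0124}$, $f(\mathtt{2})=\mathtt{0120323}$, $f(\mathtt{3})=\mathtt{01240324}$, $f(\mathtt{4})=\mathtt{01240323}$. -}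

module Defs where

open import Data.Nat using (ℕ; zero; suc; _+_; _≥_)
open import Data.Fin using (Fin; toℕ)
open import Data.List using (List; []; _∷_; _++_; concatMap; length; lookup)
open import Data.Product using (Σ; ∃; _×_; _,_)
open import Data.Sum using (_⊎_)
open import Relation.Binary.PropositionalEquality using (_≡_)
open import Function using (_∘_)

data Letter : Set where
  l0 l1 l2 l3 l4 : Letter

Word : Set
Word = List Letter

F₁ : Letter → Word
F₁ l0 = l0 ∷ l1 ∷ []
F₁ l1 = l2 ∷ []
F₁ l2 = l0 ∷ l3 ∷ []
F₁ l3 = l2 ∷ l4 ∷ []
F₁ l4 = l2 ∷ l3 ∷ []

F : Word → Word
F = concatMap F₁

iter : ℕ → (Word → Word) → Word → Word
iter zero    g w = w
iter (suc n) g w = g (iter n g w)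

f : Word → Word
f = F ∘ F ∘ F

-- n-th letter of a finite word, with a default (never used below)
nth : Word → ℕ → Letter
nth []      _       = l0
nth (a ∷ w) zero    = a
nth (a ∷ w) (suc n) = nth w n

-- The infinite fixed point F^ω(0): F^n(0) is a prefix of F^{n+1}(0) and
-- has length ≥ n+1, so its n-th letter is the n-th letter of F^ω(0).
Fω : ℕ → Letter
Fω n = nth (iter n F (l0 ∷ [])) n

IsFactor : Word → (ℕ → Letter) → Set
IsFactor w x = ∃ λ i → (j : Fin (length w)) → x (i + toℕ j) ≡ lookup w j

IsConjugate : Word → Word → Set
IsConjugate u v = Σ Word λ x → Σ Word λ y → (u ≡ x ++ y) × (v ≡ y ++ x)

InC : Word → Set
InC w = (w ≡ F (l2 ∷ []))
      ⊎ (w ≡ F (F (l2 ∷ [])))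
      ⊎ (∃ λ d → d ≥ 1 × (w ≡ iter d F (l4 ∷ [])))
      ⊎ (∃ λ d → d ≥ 1 × (w ≡ iter d f (l0 ∷ [])))

-- Call u almost circular if every conjugate of u is a factor of F^ω(0), except
-- that a final 1 may stand for a 3 or a 4, and a final 0 for a 2.  Images of
-- letters begin with 0 or 2, while 1, 3 and 4 only occur as second letters of
-- images, so an almost circular word of length ≥ 3, rotated to begin with 0 or
-- 2, cuts uniquely into images: it is F v for a strictly shorter almost
-- circular word v.  By induction on the length, every almost circular word of
-- length ≥ 2 is conjugate to 12, F(2), F²(2), Fⁿ(0) or Fⁿ(4) with n ≥ 1: the
-- words of length 2 are read off the allowed two-letter factors, and F(12),
-- F³(2) are excluded since their conjugates 320, 3012032 are not almost
-- factors.  Finally 21 is not a factor, and if n ≢ 0 mod 3 then moving the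
-- suffix of Fⁿ(0) that starts at its last 1 to the front gives a non-factor,
-- so that Fⁿ(0) = f^(n/3)(0).

module Submission where

open import Defs
open import Data.Nat using (ℕ; zero; suc; _+_; _≤_; _<_; _≥_; z≤n; s≤s; _≤′_; ≤′-refl; ≤′-step)
open import Data.Nat.Properties using (≤-refl; ≤-trans; <⇒≤; ≤-pred; n≤1+n; +-monoʳ-≤; ≤⇒≤′; module ≤-Reasoning)
open import Data.List using (List; []; _∷_; _++_; [_]; _∷ʳ_; length; lookup; last; head)
open import Data.List.Properties
  using (∷-injective; ∷-injectiveˡ; ∷ʳ-injective; ∷ʳ-injectiveˡ; ∷ʳ-injectiveʳ; ∷ʳ-++; ++-assoc; ++-identityʳ;
         ++-cancelˡ; concatMap-++; length-++-comm; length-++-≤ˡ; length-++-sucʳ)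
open import Data.Fin using (Fin; zero; suc; toℕ; fromℕ<)
open import Data.Fin.Properties using (toℕ-fromℕ<)
open import Data.List.Reverse using ([]; _∶_∶ʳ_; reverseView)
open import Data.List.Relation.Unary.Linked as Linked using (Linked; []; [-]; _∷_)
open import Data.List.Relation.Unary.Linked.Properties using (++⁺)
open import Data.Maybe.Relation.Binary.Connected using (Connected; just)
open import Data.Product using (Σ; ∃₂; ∃-syntax; _×_; _,_; proj₁; proj₂)
open import Data.Sum using (_⊎_; inj₁; inj₂)
open import Data.Empty using (⊥; ⊥-elim)
open import Relation.Nullary using (¬_)
open import Relation.Binary.PropositionalEquality
  using (_≡_; _≢_; refl; sym; trans; cong; subst; module ≡-Reasoning)

++-overlap : ∀ {A : Set} (a b c d : List A) → a ++ b ≡ c ++ d →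
  (∃[ m ] c ≡ a ++ m × b ≡ m ++ d) ⊎ (∃[ m ] a ≡ c ++ m × d ≡ m ++ b)
++-overlap []      b c       d eq = inj₁ (c , refl , eq)
++-overlap (x ∷ a) b []      d eq = inj₂ (x ∷ a , refl , sym eq)
++-overlap (x ∷ a) b (y ∷ c) d eq with ∷-injective eq
... | refl , eq′ with ++-overlap a b c d eq′
... | inj₁ (m , p , q) = inj₁ (m , cong (x ∷_) p , q)
... | inj₂ (m , p , q) = inj₂ (m , cong (x ∷_) p , q)

∷-as-∷ʳ : ∀ {A : Set} (x : A) xs → ∃₂ λ ys y → x ∷ xs ≡ ys ∷ʳ y
∷-as-∷ʳ x []       = [] , x , refl
∷-as-∷ʳ x (x′ ∷ xs) with ∷-as-∷ʳ x′ xs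
... | ys , y , eq = x ∷ ys , y , cong (x ∷_) eq

module _ {A : Set} {R : A → A → Set} where

  Linked-++⁻ˡ : ∀ xs {ys} → Linked R (xs ++ ys) → Linked R xs
  Linked-++⁻ˡ []           _        = []
  Linked-++⁻ˡ (x ∷ [])     _        = [-]
  Linked-++⁻ˡ (x ∷ y ∷ xs) (r ∷ rs) = r ∷ Linked-++⁻ˡ (y ∷ xs) rs

  Linked-++⁻ʳ : ∀ xs {ys} → Linked R (xs ++ ys) → Linked R ys
  Linked-++⁻ʳ []       rs = rs
  Linked-++⁻ʳ (x ∷ xs) rs = Linked-++⁻ʳ xs (Linked.tail rs)

-- Blocks of the morphism F

data Initial : Letter → Set where
  i0 : Initial l0
  i2 : Initial l2

data NonInitial : Letter → Set where
  n1 : NonInitial l1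
  n3 : NonInitial l3
  n4 : NonInitial l4

initial-nonInitial : ∀ {c} → Initial c → NonInitial c → ⊥
initial-nonInitial i0 ()
initial-nonInitial i2 ()

blockHead : Letter → Letter
blockHead l0 = l0
blockHead l1 = l2
blockHead l2 = l0
blockHead l3 = l2
blockHead l4 = l2

blockInit : Letter → Word
blockInit l0 = l0 ∷ []
blockInit l1 = []
blockInit l2 = l0 ∷ []
blockInit l3 = l2 ∷ []
blockInit l4 = l2 ∷ []

blockLast : Letter → Letter
blockLast l0 = l1
blockLast l1 = l2
blockLast l2 = l3
blockLast l3 = l4
blockLast l4 = l3

blockHead-initial : ∀ x → Initial (blockHead x)
blockHead-initial l0 = i0
blockHead-initial l1 = i2
blockHead-initial l2 = i0
blockHead-initial l3 = i2
blockHead-initial l4 = i2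

blockLast-nonInitial : ∀ {x} → x ≢ l1 → NonInitial (blockLast x)
blockLast-nonInitial {l0} _   = n1
blockLast-nonInitial {l1} x≢1 = ⊥-elim (x≢1 refl)
blockLast-nonInitial {l2} _   = n3
blockLast-nonInitial {l3} _   = n4
blockLast-nonInitial {l4} _   = n3

F-++ : ∀ u v → F (u ++ v) ≡ F u ++ F v
F-++ = concatMap-++ F₁

f-++ : ∀ u v → f (u ++ v) ≡ f u ++ f v
f-++ u v = begin
  F (F (F (u ++ v)))               ≡⟨ cong (λ w → F (F w)) (F-++ u v) ⟩
  F (F (F u ++ F v))               ≡⟨ cong F (F-++ (F u) (F v)) ⟩
  F (F (F u) ++ F (F v))           ≡⟨ F-++ (F (F u)) (F (F v)) ⟩
  f u ++ f v                       ∎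
  where open ≡-Reasoning

F-∷ : ∀ y Y → ∃[ s ] F (y ∷ Y) ≡ blockHead y ∷ s
F-∷ l0 Y = _ , refl
F-∷ l1 Y = _ , refl
F-∷ l2 Y = _ , refl
F-∷ l3 Y = _ , refl
F-∷ l4 Y = _ , refl

F-∷ʳ : ∀ p x → F (p ∷ʳ x) ≡ (F p ++ blockInit x) ∷ʳ blockLast x
F-∷ʳ p x = begin
  F (p ∷ʳ x)                        ≡⟨ F-++ p [ x ] ⟩
  F p ++ F₁ x ++ []                 ≡⟨ cong (F p ++_) (++-identityʳ (F₁ x)) ⟩
  F p ++ F₁ x                       ≡⟨ cong (F p ++_) (block x) ⟩
  F p ++ blockInit x ∷ʳ blockLast x ≡⟨ ++-assoc (F p) (blockInit x) _ ⟨
  (F p ++ blockInit x) ∷ʳ blockLast x ∎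
  where
  open ≡-Reasoning
  block : ∀ x → F₁ x ≡ blockInit x ∷ʳ blockLast x
  block l0 = refl
  block l1 = refl
  block l2 = refl
  block l3 = refl
  block l4 = refl

blockHead-F : ∀ y Y {c s} → F (y ∷ Y) ≡ c ∷ s → blockHead y ≡ c
blockHead-F y Y eq with F-∷ y Y
... | _ , eq′ = ∷-injectiveˡ (trans (sym eq′) eq)

F-head-initial : ∀ Y {c s} → F Y ≡ c ∷ s → Initial c
F-head-initial (y ∷ Y) eq = subst Initial (blockHead-F y Y eq) (blockHead-initial y)

F₁-inner : ∀ y {x} a {c s} → F₁ y ≡ x ∷ a ++ c ∷ s → NonInitial c
F₁-inner l0 []          refl = n1
F₁-inner l0 (_ ∷ [])    ()
F₁-inner l0 (_ ∷ _ ∷ _) ()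
F₁-inner l1 []          ()
F₁-inner l1 (_ ∷ _)     ()
F₁-inner l2 []          refl = n3
F₁-inner l2 (_ ∷ [])    ()
F₁-inner l2 (_ ∷ _ ∷ _) ()
F₁-inner l3 []          refl = n4
F₁-inner l3 (_ ∷ [])    ()
F₁-inner l3 (_ ∷ _ ∷ _) ()
F₁-inner l4 []          refl = n3
F₁-inner l4 (_ ∷ [])    ()
F₁-inner l4 (_ ∷ _ ∷ _) ()

-- Inside a block only non-initial letters occur, so an initial letter of F Y starts a block.
F-cut : ∀ Y a {c} s → Initial c → F Y ≡ a ++ c ∷ s →
  ∃₂ λ Y₁ Y₂ → Y ≡ Y₁ ++ Y₂ × F Y₁ ≡ a × F Y₂ ≡ c ∷ s
F-cut [] [] s ic ()
F-cut [] (_ ∷ _) s ic ()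
F-cut (y ∷ Y) a {c} s ic eq with ++-overlap (F₁ y) (F Y) a (c ∷ s) eq
... | inj₁ (m , a≡ , FY≡) with F-cut Y m s ic FY≡
...   | Y₁ , Y₂ , refl , refl , FY₂ = y ∷ Y₁ , Y₂ , refl , sym a≡ , FY₂
F-cut (y ∷ Y) a s ic eq | inj₂ ([] , F₁y≡ , FY≡) =
  y ∷ [] , Y , refl , trans (++-identityʳ (F₁ y)) (trans F₁y≡ (++-identityʳ a)) , sym FY≡
F-cut (y ∷ Y) [] s ic eq | inj₂ (m ∷ ms , F₁y≡ , FY≡) =
  [] , y ∷ Y , refl , refl , trans (cong (_++ F Y) F₁y≡) (sym FY≡)
F-cut (y ∷ Y) (x ∷ a) s ic eq | inj₂ (m ∷ ms , F₁y≡ , refl) =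
  ⊥-elim (initial-nonInitial ic (F₁-inner y a F₁y≡))

-- The first block of an F-image is determined by its first two letters.
decodeBlock : Word → Letter
decodeBlock (l0 ∷ l1 ∷ _) = l0
decodeBlock (l0 ∷ _)      = l2
decodeBlock (l2 ∷ l4 ∷ _) = l3
decodeBlock (l2 ∷ l3 ∷ _) = l4
decodeBlock _             = l1

decodeBlock-F : ∀ y Y → decodeBlock (F (y ∷ Y)) ≡ y
decodeBlock-F l0 Y        = refl
decodeBlock-F l1 []       = refl
decodeBlock-F l1 (l0 ∷ Y) = refl
decodeBlock-F l1 (l1 ∷ Y) = refl
decodeBlock-F l1 (l2 ∷ Y) = refl
decodeBlock-F l1 (l3 ∷ Y) = refl
decodeBlock-F l1 (l4 ∷ Y) = refl
decodeBlock-F l2 Y        = refl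
decodeBlock-F l3 Y        = refl
decodeBlock-F l4 Y        = refl

F-injective : ∀ u v → F u ≡ F v → u ≡ v
F-injective []      []      _  = refl
F-injective []      (y ∷ v) eq with F-∷ y v
... | _ , eq′ with trans eq eq′
... | ()
F-injective (x ∷ u) []      eq with F-∷ x u
... | _ , eq′ with trans (sym eq) eq′
... | ()
F-injective (x ∷ u) (y ∷ v) eq
  with refl ← trans (sym (decodeBlock-F x u)) (trans (cong decodeBlock eq) (decodeBlock-F y v))
  = cong (x ∷_) (F-injective u v (++-cancelˡ (F₁ x) (F u) (F v) eq))

F-infix⁻¹ : ∀ Y a w {c} s → Initial c → F Y ≡ a ++ F w ++ c ∷ s →
  ∃₂ λ Y₁ Y₂ → Y ≡ Y₁ ++ w ++ Y₂ × F Y₂ ≡ c ∷ s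
F-infix⁻¹ Y a [] s ic eq with F-cut Y a s ic eq
... | Y₁ , Y₂ , Y≡ , _ , FY₂ = Y₁ , Y₂ , Y≡ , FY₂
F-infix⁻¹ Y a (x ∷ w) {c} s ic eq
  with F-∷ x w
... | t , Fxw≡
  with F-cut Y a (t ++ c ∷ s) (blockHead-initial x) (trans eq (cong (λ z → a ++ z ++ c ∷ s) Fxw≡))
... | Y₁ , Y′ , refl , _ , FY′
  with F-cut Y′ (F (x ∷ w)) s ic (trans FY′ (cong (_++ c ∷ s) (sym Fxw≡)))
... | Y₂ , Y₃ , refl , FY₂ , FY₃ =
  Y₁ , Y₃ , cong (λ z → Y₁ ++ z ++ Y₃) (F-injective Y₂ (x ∷ w) FY₂) , FY₃

-- Factors of the fixed point

F^[_]0 : ℕ → Word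
F^[ m ]0 = iter m F (l0 ∷ [])

F^0-grows : ∀ m → ∃₂ λ d t → F^[ suc m ]0 ≡ F^[ m ]0 ++ d ∷ t
F^0-grows zero = l1 , [] , refl
F^0-grows (suc m) with F^0-grows m
... | d , t , eq with F-∷ d t
... | s , eq′ = blockHead d , s , (begin
  F F^[ suc m ]0                  ≡⟨ cong F eq ⟩
  F (F^[ m ]0 ++ d ∷ t)           ≡⟨ F-++ F^[ m ]0 (d ∷ t) ⟩
  F^[ suc m ]0 ++ F (d ∷ t)       ≡⟨ cong (F^[ suc m ]0 ++_) eq′ ⟩
  F^[ suc m ]0 ++ blockHead d ∷ s ∎)
  where open ≡-Reasoning

F^0-head-initial : ∀ m {c s} → F^[ m ]0 ≡ c ∷ s → Initial c
F^0-head-initial zero    refl = i0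
F^0-head-initial (suc m) eq   = F-head-initial F^[ m ]0 eq

data Factor (w : Word) : Set where
  occurs : ∀ m a b → F^[ m ]0 ≡ a ++ w ++ b → Factor w

Factor-infix : ∀ a w b → Factor (a ++ w ++ b) → Factor w
Factor-infix a w b (occurs m a′ b′ eq) = occurs m (a′ ++ a) (b ++ b′) (begin
  F^[ m ]0                  ≡⟨ eq ⟩
  a′ ++ (a ++ w ++ b) ++ b′ ≡⟨ cong (a′ ++_) (++-assoc a (w ++ b) b′) ⟩
  a′ ++ a ++ (w ++ b) ++ b′ ≡⟨ cong (λ z → a′ ++ a ++ z) (++-assoc w b b′) ⟩
  a′ ++ a ++ w ++ b ++ b′   ≡⟨ ++-assoc a′ a (w ++ b ++ b′) ⟨
  (a′ ++ a) ++ w ++ b ++ b′ ∎)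
  where open ≡-Reasoning

Factor-prefix : ∀ w b → Factor (w ++ b) → Factor w
Factor-prefix w b = Factor-infix [] w b

Factor-suffix : ∀ a w → Factor (a ++ w) → Factor w
Factor-suffix a w fa = Factor-infix a w [] (subst Factor (cong (a ++_) (sym (++-identityʳ w))) fa)

Factor-inImage : ∀ {w} → Factor w → ∃[ m ] ∃₂ λ a b → F F^[ m ]0 ≡ a ++ w ++ b
Factor-inImage {w} (occurs m a b eq) with F^0-grows m
... | d , t , eq′ = m , a , b ++ d ∷ t , (begin
  F^[ suc m ]0               ≡⟨ eq′ ⟩
  F^[ m ]0 ++ d ∷ t          ≡⟨ cong (_++ d ∷ t) eq ⟩
  (a ++ w ++ b) ++ d ∷ t     ≡⟨ ++-assoc a (w ++ b) (d ∷ t) ⟩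
  a ++ (w ++ b) ++ d ∷ t     ≡⟨ cong (a ++_) (++-assoc w b (d ∷ t)) ⟩
  a ++ w ++ b ++ d ∷ t       ∎)
  where open ≡-Reasoning

Factor-extendʳ : ∀ {w} → Factor w → ∃[ d ] Factor (w ∷ʳ d)
Factor-extendʳ {w} (occurs m a (d ∷ b) eq) = d , occurs m a b (trans eq (cong (a ++_) (sym (∷ʳ-++ w d b))))
Factor-extendʳ {w} (occurs m a [] eq) with F^0-grows m
... | d , t , eq′ = d , occurs (suc m) a t (begin
  F^[ suc m ]0               ≡⟨ eq′ ⟩
  F^[ m ]0 ++ d ∷ t          ≡⟨ cong (_++ d ∷ t) eq ⟩
  (a ++ w ++ []) ++ d ∷ t    ≡⟨ ++-assoc a (w ++ []) (d ∷ t) ⟩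
  a ++ (w ++ []) ++ d ∷ t    ≡⟨ cong (λ z → a ++ z ++ d ∷ t) (++-identityʳ w) ⟩
  a ++ w ++ d ∷ t            ≡⟨ cong (a ++_) (∷ʳ-++ w d t) ⟨
  a ++ (w ∷ʳ d) ++ t         ∎)
  where open ≡-Reasoning

infix 4 _⇢_

data _⇢_ : Letter → Letter → Set where
  0⇢1 : l0 ⇢ l1
  0⇢3 : l0 ⇢ l3
  1⇢2 : l1 ⇢ l2
  2⇢0 : l2 ⇢ l0
  2⇢3 : l2 ⇢ l3
  2⇢4 : l2 ⇢ l4
  3⇢0 : l3 ⇢ l0
  3⇢2 : l3 ⇢ l2
  4⇢0 : l4 ⇢ l0

nonInitial-⇢ : ∀ {c d} → NonInitial c → c ⇢ d → Initial d
nonInitial-⇢ n1 1⇢2 = i2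
nonInitial-⇢ n3 3⇢0 = i0
nonInitial-⇢ n3 3⇢2 = i2
nonInitial-⇢ n4 4⇢0 = i0

F₁-linked : ∀ x → Linked _⇢_ (F₁ x)
F₁-linked l0 = 0⇢1 ∷ [-]
F₁-linked l1 = [-]
F₁-linked l2 = 0⇢3 ∷ [-]
F₁-linked l3 = 2⇢4 ∷ [-]
F₁-linked l4 = 2⇢3 ∷ [-]

F-linked : ∀ {w} → Linked _⇢_ w → Linked _⇢_ (F w)
F-linked []                      = []
F-linked ([-] {x})               = subst (Linked _⇢_) (sym (++-identityʳ (F₁ x))) (F₁-linked x)
F-linked (_∷_ {x} {y} {w} x⇢y l) = ++⁺ (F₁-linked x) (junction x⇢y) (F-linked l)
  where
  junction : ∀ {x y} → x ⇢ y → Connected _⇢_ (last (F₁ x)) (head (F (y ∷ w)))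
  junction 0⇢1 = just 1⇢2
  junction 0⇢3 = just 1⇢2
  junction 1⇢2 = just 2⇢0
  junction 2⇢0 = just 3⇢0
  junction 2⇢3 = just 3⇢2
  junction 2⇢4 = just 3⇢2
  junction 3⇢0 = just 4⇢0
  junction 3⇢2 = just 4⇢0
  junction 4⇢0 = just 3⇢0

F^0-linked : ∀ m → Linked _⇢_ F^[ m ]0
F^0-linked zero    = [-]
F^0-linked (suc m) = F-linked (F^0-linked m)

Factor-linked : ∀ {w} → Factor w → Linked _⇢_ w
Factor-linked {w} (occurs m a b eq) =
  Linked-++⁻ˡ w (Linked-++⁻ʳ a (subst (Linked _⇢_) eq (F^0-linked m)))

Factor-⇢ : ∀ {c d w} → Factor (c ∷ d ∷ w) → c ⇢ d
Factor-⇢ fa = Linked.head (Factor-linked fa)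

Factor-extendˡ : ∀ {c w} → NonInitial c → Factor (c ∷ w) → ∃[ p ] p ⇢ c × Factor (p ∷ c ∷ w)
Factor-extendˡ {c} {w} nc (occurs m a b eq) with reverseView a
... | []           = ⊥-elim (initial-nonInitial (F^0-head-initial m eq) nc)
... | a′ ∶ _ ∶ʳ p = p , Factor-⇢ fa , fa
  where
  fa : Factor (p ∷ c ∷ w)
  fa = occurs m a′ b (trans eq (∷ʳ-++ a′ p (c ∷ w ++ b)))

Factor-F⁻¹ : ∀ w {c} s → Initial c → Factor (F w ++ c ∷ s) → ∃[ y ] blockHead y ≡ c × Factor (w ∷ʳ y)
Factor-F⁻¹ w {c} s ic fa with Factor-inImage fa
... | m , a , b , eq
  with F-infix⁻¹ F^[ m ]0 a w (s ++ b) ic (trans eq (cong (a ++_) (++-assoc (F w) (c ∷ s) b)))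
... | Y₁ , y ∷ Y₂ , eq′ , FY₂ =
  y , blockHead-F y Y₂ FY₂ , occurs m Y₁ Y₂ (trans eq′ (cong (Y₁ ++_) (sym (∷ʳ-++ w y Y₂))))

Factor-F⁻¹-cut : ∀ w {c} s → Initial c → Factor (F w ++ c ∷ s) → Factor w
Factor-F⁻¹-cut w s ic fa with Factor-F⁻¹ w s ic fa
... | y , _ , fy = Factor-prefix w [ y ] fy

-- As 1, 3 and 4 only end blocks, in F^ω(0) the factor F (p ∷ʳ x) is followed by a block.
Factor-F⁻¹-∷ʳ : ∀ p x → x ≢ l1 → Factor (F (p ∷ʳ x)) → Factor (p ∷ʳ x)
Factor-F⁻¹-∷ʳ p x x≢1 fa with Factor-extendʳ fa
... | d , fd = Factor-F⁻¹-cut (p ∷ʳ x) [] (nonInitial-⇢ (blockLast-nonInitial x≢1) last⇢d) fd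
  where
  q = F p ++ blockInit x
  last⇢d : blockLast x ⇢ d
  last⇢d = Factor-⇢ (Factor-suffix q _
    (subst Factor (trans (cong (_∷ʳ d) (F-∷ʳ p x)) (++-assoc q [ blockLast x ] [ d ])) fd))

-- Desubstituting a factor ending in 2 = F 1 only shows that the preimage ends
-- in 1, 3 or 4, as the 2 may begin 24 = F 3 or 23 = F 4; this weakening is
-- stable under desubstitution once a final 0 may also stand for 2.
data AlmostFactor (w : Word) : Set where
  factor  : Factor w → AlmostFactor w
  1-for-3 : ∀ {p} → w ≡ p ∷ʳ l1 → Factor (p ∷ʳ l3) → AlmostFactor w
  1-for-4 : ∀ {p} → w ≡ p ∷ʳ l1 → Factor (p ∷ʳ l4) → AlmostFactor w
  0-for-2 : ∀ {p} → w ≡ p ∷ʳ l0 → Factor (p ∷ʳ l2) → AlmostFactor w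

AlmostFactor-init : ∀ w z → AlmostFactor (w ∷ʳ z) → Factor w
AlmostFactor-init w z (factor fa)     = Factor-prefix w [ z ] fa
AlmostFactor-init w z (1-for-3 eq fa) = subst Factor (sym (∷ʳ-injectiveˡ w _ eq)) (Factor-prefix _ _ fa)
AlmostFactor-init w z (1-for-4 eq fa) = subst Factor (sym (∷ʳ-injectiveˡ w _ eq)) (Factor-prefix _ _ fa)
AlmostFactor-init w z (0-for-2 eq fa) = subst Factor (sym (∷ʳ-injectiveˡ w _ eq)) (Factor-prefix _ _ fa)

AlmostFactor-⇢ : ∀ {c d e t} → AlmostFactor (c ∷ d ∷ e ∷ t) → c ⇢ d
AlmostFactor-⇢ {c} {d} {e} {t} af with ∷-as-∷ʳ e t
... | q , z , eq =
  Factor-⇢ (AlmostFactor-init (c ∷ d ∷ q) z (subst AlmostFactor (cong (λ r → c ∷ d ∷ r) eq) af))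

AlmostFactor-F⁻¹ : ∀ w → AlmostFactor (F w) → AlmostFactor w
AlmostFactor-F⁻¹ w af with reverseView w
... | []          = factor (occurs 0 [] (l0 ∷ []) refl)
... | p ∶ _ ∶ʳ x = desubstitute x af
  where
  split-last : ∀ x {q z} → F (p ∷ʳ x) ≡ q ∷ʳ z → q ≡ F p ++ blockInit x × z ≡ blockLast x
  split-last x {q} eq = ∷ʳ-injective q _ (trans (sym eq) (F-∷ʳ p x))

  ends-in-1 : ∀ x {q} → F (p ∷ʳ x) ≡ q ∷ʳ l1 → x ≡ l0 × q ≡ F p ∷ʳ l0
  ends-in-1 l0 eq = refl , proj₁ (split-last l0 eq)
  ends-in-1 l1 eq with () ← proj₂ (split-last l1 eq)
  ends-in-1 l2 eq with () ← proj₂ (split-last l2 eq)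
  ends-in-1 l3 eq with () ← proj₂ (split-last l3 eq)
  ends-in-1 l4 eq with () ← proj₂ (split-last l4 eq)

  ends-in-0 : ∀ x {q} → F (p ∷ʳ x) ≢ q ∷ʳ l0
  ends-in-0 l0 eq with () ← proj₂ (split-last l0 eq)
  ends-in-0 l1 eq with () ← proj₂ (split-last l1 eq)
  ends-in-0 l2 eq with () ← proj₂ (split-last l2 eq)
  ends-in-0 l3 eq with () ← proj₂ (split-last l3 eq)
  ends-in-0 l4 eq with () ← proj₂ (split-last l4 eq)

  desubstitute : ∀ x → AlmostFactor (F (p ∷ʳ x)) → AlmostFactor (p ∷ʳ x)
  desubstitute l0 (factor fa) = factor (Factor-F⁻¹-∷ʳ p l0 (λ ()) fa)
  desubstitute l2 (factor fa) = factor (Factor-F⁻¹-∷ʳ p l2 (λ ()) fa)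
  desubstitute l3 (factor fa) = factor (Factor-F⁻¹-∷ʳ p l3 (λ ()) fa)
  desubstitute l4 (factor fa) = factor (Factor-F⁻¹-∷ʳ p l4 (λ ()) fa)
  desubstitute l1 (factor fa) with Factor-F⁻¹ p [] i2 (subst Factor (F-++ p [ l1 ]) fa)
  ... | l1 , _ , fy = factor fy
  ... | l3 , _ , fy = 1-for-3 refl fy
  ... | l4 , _ , fy = 1-for-4 refl fy
  desubstitute x (1-for-3 eq fa) with ends-in-1 x eq
  ... | refl , refl =
    0-for-2 refl (Factor-F⁻¹-∷ʳ p l2 (λ ()) (subst Factor (trans (++-assoc (F p) _ _) (sym (F-++ p _))) fa))
  desubstitute x (1-for-4 eq fa) with ends-in-1 x eq
  ... | refl , refl with () ← Factor-⇢ (Factor-suffix (F p) _ (subst Factor (++-assoc (F p) _ _) fa))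
  desubstitute x (0-for-2 eq _) = ⊥-elim (ends-in-0 x eq)

-- Circular words

conjugate-refl : ∀ u → IsConjugate u u
conjugate-refl u = [] , u , refl , sym (++-identityʳ u)

conjugate-sym : ∀ {u v} → IsConjugate u v → IsConjugate v u
conjugate-sym (x , y , u≡ , v≡) = y , x , v≡ , u≡

conjugate-trans : ∀ {u v w} → IsConjugate u v → IsConjugate v w → IsConjugate u w
conjugate-trans (x , y , u≡ , v≡) (x′ , y′ , v≡′ , w≡) with ++-overlap y x x′ y′ (trans (sym v≡) v≡′)
... | inj₁ (m , x′≡ , x≡) = m , y′ ++ y ,
      trans u≡ (trans (cong (_++ y) x≡) (++-assoc m y′ y)) ,
      trans w≡ (trans (cong (y′ ++_) x′≡) (sym (++-assoc y′ y m)))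
... | inj₂ (m , y≡ , y′≡) = x ++ x′ , m ,
      trans u≡ (trans (cong (x ++_) y≡) (sym (++-assoc x x′ m))) ,
      trans w≡ (trans (cong (_++ x′) y′≡) (++-assoc m x x′))

conjugate-F : ∀ {u v} → IsConjugate u v → IsConjugate (F u) (F v)
conjugate-F (x , y , refl , refl) = F x , F y , F-++ x y , F-++ y x

conjugate-length : ∀ {u v} → IsConjugate u v → length u ≡ length v
conjugate-length (x , y , refl , refl) = length-++-comm x y

AlmostCircular : Word → Set
AlmostCircular u = ∀ v → IsConjugate u v → AlmostFactor v

AlmostCircular-conjugate : ∀ {u v} → AlmostCircular u → IsConjugate u v → AlmostCircular v
AlmostCircular-conjugate circ u~v w v~w = circ w (conjugate-trans u~v v~w)

AlmostCircular-F⁻¹ : ∀ {v} → AlmostCircular (F v) → AlmostCircular v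
AlmostCircular-F⁻¹ circ w v~w = AlmostFactor-F⁻¹ w (circ (F w) (conjugate-F v~w))

AlmostCircular-⇢ : ∀ {u c d t} → AlmostCircular u → 3 ≤ length u → IsConjugate u (c ∷ d ∷ t) → c ⇢ d
AlmostCircular-⇢ {t = []}    circ len u~cd with subst (3 ≤_) (conjugate-length u~cd) len
... | s≤s (s≤s ())
AlmostCircular-⇢ {t = _ ∷ _} circ len u~cdt = AlmostFactor-⇢ (circ _ u~cdt)

module _ {R : Letter → Letter → Set} where

  rotations-linked : ∀ x y r → (∀ {c d t} → IsConjugate (x ∷ y ∷ r) (c ∷ d ∷ t) → R c d) →
    Linked R ((x ∷ y ∷ r) ∷ʳ x)
  rotations-linked x y r rot = go [] (x ∷ y ∷ r) refl
    where
    go : ∀ a s → x ∷ y ∷ r ≡ a ++ s → Linked R (s ∷ʳ x)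
    go a       []            _  = [-]
    go []      (c ∷ [])      ()
    go (a ∷ as) (c ∷ [])     eq with refl ← ∷-injectiveˡ eq = rot (a ∷ as , [ c ] , eq , refl) ∷ [-]
    go a       (c ∷ d ∷ s)   eq =
      rot (a , c ∷ d ∷ s , eq , refl) ∷ go (a ∷ʳ c) (d ∷ s) (trans eq (sym (∷ʳ-++ a c (d ∷ s))))

data BlockStart : Word → Set where
  end   : BlockStart []
  start : ∀ {c w} → Initial c → BlockStart (c ∷ w)

nextBlock : ∀ {x} w {c} → NonInitial x → Linked _⇢_ (x ∷ w ∷ʳ c) → BlockStart w
nextBlock []      _  _       = end
nextBlock (_ ∷ _) nx (r ∷ _) = start (nonInitial-⇢ nx r)

-- Reads a word as a concatenation of blocks F₁ x from the left (junk on other inputs).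
parse : Word → Word
parse (l0 ∷ l1 ∷ w) = l0 ∷ parse w
parse (l0 ∷ l3 ∷ w) = l2 ∷ parse w
parse (l2 ∷ l4 ∷ w) = l3 ∷ parse w
parse (l2 ∷ l3 ∷ w) = l4 ∷ parse w
parse (l2 ∷ w)      = l1 ∷ parse w
parse _             = []

F-parse : ∀ w {c} → Initial c → BlockStart w → Linked _⇢_ (w ∷ʳ c) → F (parse w) ≡ w
F-parse []            ic _          l        = refl
F-parse (l0 ∷ [])     () _          (0⇢1 ∷ _)
F-parse (l0 ∷ [])     () _          (0⇢3 ∷ _)
F-parse (l0 ∷ l1 ∷ w) ic _          (_ ∷ l) =
  cong (λ z → l0 ∷ l1 ∷ z) (F-parse w ic (nextBlock w n1 l) (Linked.tail l))
F-parse (l0 ∷ l3 ∷ w) ic _          (_ ∷ l) =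
  cong (λ z → l0 ∷ l3 ∷ z) (F-parse w ic (nextBlock w n3 l) (Linked.tail l))
F-parse (l0 ∷ l0 ∷ w) ic _          (() ∷ _)
F-parse (l0 ∷ l2 ∷ w) ic _          (() ∷ _)
F-parse (l0 ∷ l4 ∷ w) ic _          (() ∷ _)
F-parse (l2 ∷ [])     ic _          l        = refl
F-parse (l2 ∷ l4 ∷ w) ic _          (_ ∷ l) =
  cong (λ z → l2 ∷ l4 ∷ z) (F-parse w ic (nextBlock w n4 l) (Linked.tail l))
F-parse (l2 ∷ l3 ∷ w) ic _          (_ ∷ l) =
  cong (λ z → l2 ∷ l3 ∷ z) (F-parse w ic (nextBlock w n3 l) (Linked.tail l))
F-parse (l2 ∷ l0 ∷ w) ic _          (_ ∷ l) = cong (l2 ∷_) (F-parse (l0 ∷ w) ic (start i0) l)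
F-parse (l2 ∷ l1 ∷ w) ic _          (() ∷ _)
F-parse (l2 ∷ l2 ∷ w) ic _          (() ∷ _)
F-parse (l1 ∷ w)      ic (start ()) l
F-parse (l3 ∷ w)      ic (start ()) l
F-parse (l4 ∷ w)      ic (start ()) l

length-F : ∀ v → length v ≤ length (F v)
length-F []      = z≤n
length-F (x ∷ v) = ≤-trans (s≤s (length-F v)) (block x)
  where
  block : ∀ x → suc (length (F v)) ≤ length (F (x ∷ v))
  block l0 = s≤s (n≤1+n _)
  block l1 = ≤-refl
  block l2 = s≤s (n≤1+n _)
  block l3 = s≤s (n≤1+n _)
  block l4 = s≤s (n≤1+n _)

length-F-∷ : ∀ x v → x ≢ l1 → length (x ∷ v) < length (F (x ∷ v))
length-F-∷ l0 v _   = s≤s (s≤s (length-F v))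
length-F-∷ l1 v x≢1 = ⊥-elim (x≢1 refl)
length-F-∷ l2 v _   = s≤s (s≤s (length-F v))
length-F-∷ l3 v _   = s≤s (s≤s (length-F v))
length-F-∷ l4 v _   = s≤s (s≤s (length-F v))

-- Only 1 is not lengthened by F, and 22 is not an allowed pair.
F-lengthens : ∀ v {w} → F v ≡ w → Linked _⇢_ w → 2 ≤ length w → length v < length w
F-lengthens (l0 ∷ v)           refl _ _ = length-F-∷ l0 v (λ ())
F-lengthens (l2 ∷ v)           refl _ _ = length-F-∷ l2 v (λ ())
F-lengthens (l3 ∷ v)           refl _ _ = length-F-∷ l3 v (λ ())
F-lengthens (l4 ∷ v)           refl _ _ = length-F-∷ l4 v (λ ())
F-lengthens (l1 ∷ [])          refl _ (s≤s ())
F-lengthens (l1 ∷ l1 ∷ v)      refl (() ∷ _) _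
F-lengthens (l1 ∷ y@l0 ∷ v)    refl _ _ = s≤s (length-F-∷ y v (λ ()))
F-lengthens (l1 ∷ y@l2 ∷ v)    refl _ _ = s≤s (length-F-∷ y v (λ ()))
F-lengthens (l1 ∷ y@l3 ∷ v)    refl _ _ = s≤s (length-F-∷ y v (λ ()))
F-lengthens (l1 ∷ y@l4 ∷ v)    refl _ _ = s≤s (length-F-∷ y v (λ ()))

length-F⁻¹ : ∀ v {w} → F v ≡ w → 3 ≤ length w → 2 ≤ length v
length-F⁻¹ (_ ∷ _ ∷ _) _    _ = s≤s (s≤s z≤n)
length-F⁻¹ []          refl ()
length-F⁻¹ (l0 ∷ [])   refl (s≤s (s≤s ()))
length-F⁻¹ (l1 ∷ [])   refl (s≤s ())
length-F⁻¹ (l2 ∷ [])   refl (s≤s (s≤s ()))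
length-F⁻¹ (l3 ∷ [])   refl (s≤s (s≤s ()))
length-F⁻¹ (l4 ∷ [])   refl (s≤s (s≤s ()))

AlmostCircular-desubstitute : ∀ {c r} → Initial c → 3 ≤ length (c ∷ r) → AlmostCircular (c ∷ r) →
  ∃[ v ] F v ≡ c ∷ r × length v < length (c ∷ r) × 2 ≤ length v × AlmostCircular v
AlmostCircular-desubstitute {r = []} ic (s≤s ()) circ
AlmostCircular-desubstitute {c} {y ∷ r} ic len circ =
  parse w , Fv , F-lengthens (parse w) Fv (Linked-++⁻ˡ w linked) (s≤s (s≤s z≤n)) ,
  length-F⁻¹ (parse w) Fv len , AlmostCircular-F⁻¹ (subst AlmostCircular (sym Fv) circ)
  where
  w = c ∷ y ∷ r
  linked : Linked _⇢_ (w ∷ʳ c)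
  linked = rotations-linked c y r (AlmostCircular-⇢ circ len)
  Fv : F (parse w) ≡ w
  Fv = F-parse w ic (start ic) linked

-- Classification of almost circular words

¬Factor-303 : ¬ Factor (l3 ∷ l0 ∷ l3 ∷ [])
¬Factor-303 fa with Factor-extendˡ n3 fa
... | l0 , _ , fa′ with () ← Factor-⇢ (Factor-F⁻¹-∷ʳ [ l2 ] l2 (λ ()) fa′)
... | l2 , _ , fa′ with () ← Factor-⇢ (Factor-F⁻¹-∷ʳ [ l4 ] l2 (λ ()) fa′)

¬Factor-40123 : ¬ Factor (l4 ∷ l0 ∷ l1 ∷ l2 ∷ l3 ∷ [])
¬Factor-40123 fa with Factor-extendˡ n4 fa
... | l2 , _ , fa′ with () ← Factor-⇢ (Factor-suffix [ l3 ] _ (Factor-F⁻¹-∷ʳ (l3 ∷ l0 ∷ []) l4 (λ ()) fa′))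

¬Factor-40124 : ¬ Factor (l4 ∷ l0 ∷ l1 ∷ l2 ∷ l4 ∷ [])
¬Factor-40124 fa with Factor-extendˡ n4 fa
... | l2 , _ , fa′ = ¬Factor-303 (Factor-F⁻¹-∷ʳ (l3 ∷ l0 ∷ []) l3 (λ ()) fa′)

¬AlmostFactor-320 : ¬ AlmostFactor (l3 ∷ l2 ∷ l0 ∷ [])
¬AlmostFactor-320 (factor fa) with Factor-extendˡ n3 fa
... | l0 , _ , fa′ with () ← Factor-⇢ (Factor-F⁻¹-cut (l2 ∷ l1 ∷ []) [] i0 fa′)
... | l2 , _ , fa′ with () ← Factor-⇢ (Factor-F⁻¹-cut (l4 ∷ l1 ∷ []) [] i0 fa′)
¬AlmostFactor-320 (1-for-3 {p} eq _) with () ← ∷ʳ-injectiveʳ (l3 ∷ l2 ∷ []) p eq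
¬AlmostFactor-320 (1-for-4 {p} eq _) with () ← ∷ʳ-injectiveʳ (l3 ∷ l2 ∷ []) p eq
¬AlmostFactor-320 (0-for-2 {p} eq fa)
  with () ← Factor-⇢ (Factor-suffix [ l3 ] (l2 ∷ l2 ∷ [])
      (subst (λ q → Factor (q ∷ʳ l2)) (sym (∷ʳ-injectiveˡ (l3 ∷ l2 ∷ []) p eq)) fa))

¬AlmostFactor-3012032 : ¬ AlmostFactor (l3 ∷ l0 ∷ l1 ∷ l2 ∷ l0 ∷ l3 ∷ l2 ∷ [])
¬AlmostFactor-3012032 (factor fa) with Factor-extendˡ n3 fa
... | l0 , _ , fa′ with Factor-F⁻¹ (l2 ∷ l0 ∷ l1 ∷ l2 ∷ []) [] i2 fa′
... | y , _ , fy with () ← Factor-⇢ (Factor-F⁻¹-cut (l1 ∷ l0 ∷ []) [ y ] i2 fy)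
¬AlmostFactor-3012032 (factor fa) | l2 , _ , fa′ with Factor-F⁻¹ (l4 ∷ l0 ∷ l1 ∷ l2 ∷ []) [] i2 fa′
... | l1 , _ , fy with () ← Factor-⇢ (Factor-suffix (l4 ∷ l0 ∷ l1 ∷ []) _ fy)
... | l3 , _ , fy = ¬Factor-40123 fy
... | l4 , _ , fy = ¬Factor-40124 fy
¬AlmostFactor-3012032 (1-for-3 {p} eq _) with () ← ∷ʳ-injectiveʳ (l3 ∷ l0 ∷ l1 ∷ l2 ∷ l0 ∷ l3 ∷ []) p eq
¬AlmostFactor-3012032 (1-for-4 {p} eq _) with () ← ∷ʳ-injectiveʳ (l3 ∷ l0 ∷ l1 ∷ l2 ∷ l0 ∷ l3 ∷ []) p eq
¬AlmostFactor-3012032 (0-for-2 {p} eq _) with () ← ∷ʳ-injectiveʳ (l3 ∷ l0 ∷ l1 ∷ l2 ∷ l0 ∷ l3 ∷ []) p eq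

data Candidate : Word → Set where
  one-two : Candidate (l1 ∷ l2 ∷ [])
  F-two   : Candidate (F (l2 ∷ []))
  F²-two  : Candidate (F (F (l2 ∷ [])))
  Fⁿ-zero : ∀ {n} → n ≥ 1 → Candidate (iter n F (l0 ∷ []))
  Fⁿ-four : ∀ {n} → n ≥ 1 → Candidate (iter n F (l4 ∷ []))

Candidate-F : ∀ {s} → Candidate s → AlmostCircular (F s) → Candidate (F s)
Candidate-F one-two     circ = ⊥-elim (¬AlmostFactor-320 (circ _ (l2 ∷ l0 ∷ [] , [ l3 ] , refl , refl)))
Candidate-F F-two       _    = F²-two
Candidate-F F²-two      circ =
  ⊥-elim (¬AlmostFactor-3012032 (circ _ (l0 ∷ l1 ∷ l2 ∷ l0 ∷ l3 ∷ l2 ∷ [] , [ l3 ] , refl , refl)))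
Candidate-F (Fⁿ-zero {n} _) _ = Fⁿ-zero {suc n} (s≤s z≤n)
Candidate-F (Fⁿ-four {n} _) _ = Fⁿ-four {suc n} (s≤s z≤n)

infix 4 _⇝_

data _⇝_ : Letter → Letter → Set where
  allowed : ∀ {a b} → a ⇢ b → a ⇝ b
  2⇝1     : l2 ⇝ l1
  1⇝0     : l1 ⇝ l0

AlmostFactor-⇝ : ∀ {a b} → AlmostFactor (a ∷ b ∷ []) → a ⇝ b
AlmostFactor-⇝ (factor fa) = allowed (Factor-⇢ fa)
AlmostFactor-⇝ {a} (1-for-3 eq fa) with refl , refl ← ∷ʳ-injective [ a ] _ eq | Factor-⇢ fa
... | 0⇢3 = allowed 0⇢1
... | 2⇢3 = 2⇝1
AlmostFactor-⇝ {a} (1-for-4 eq fa) with refl , refl ← ∷ʳ-injective [ a ] _ eq | Factor-⇢ fa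
... | 2⇢4 = 2⇝1
AlmostFactor-⇝ {a} (0-for-2 eq fa) with refl , refl ← ∷ʳ-injective [ a ] _ eq | Factor-⇢ fa
... | 1⇢2 = 1⇝0
... | 3⇢2 = allowed 3⇢0

classify-pair : ∀ {a b} → a ⇝ b → b ⇝ a → ∃[ s ] Candidate s × IsConjugate s (a ∷ b ∷ [])
classify-pair (allowed 0⇢1) 1⇝0          = _ , Fⁿ-zero {1} (s≤s z≤n) , conjugate-refl _
classify-pair 1⇝0          (allowed 0⇢1) = _ , Fⁿ-zero {1} (s≤s z≤n) , [ l0 ] , [ l1 ] , refl , refl
classify-pair (allowed 0⇢3) (allowed 3⇢0) = _ , F-two , conjugate-refl _
classify-pair (allowed 3⇢0) (allowed 0⇢3) = _ , F-two , [ l0 ] , [ l3 ] , refl , refl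
classify-pair (allowed 1⇢2) 2⇝1          = _ , one-two , conjugate-refl _
classify-pair 2⇝1          (allowed 1⇢2) = _ , one-two , [ l1 ] , [ l2 ] , refl , refl
classify-pair (allowed 2⇢3) (allowed 3⇢2) = _ , Fⁿ-four {1} (s≤s z≤n) , conjugate-refl _
classify-pair (allowed 3⇢2) (allowed 2⇢3) = _ , Fⁿ-four {1} (s≤s z≤n) , [ l2 ] , [ l3 ] , refl , refl
classify-pair (allowed 2⇢0) (allowed ())
classify-pair (allowed 2⇢4) (allowed ())
classify-pair (allowed 4⇢0) (allowed ())

initial? : ∀ x → Initial x ⊎ NonInitial x
initial? l0 = inj₁ i0
initial? l1 = inj₂ n1
initial? l2 = inj₁ i2
initial? l3 = inj₂ n3
initial? l4 = inj₂ n4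

rotate-to-initial : ∀ {u} → AlmostCircular u → 3 ≤ length u → ∃₂ λ c r → Initial c × IsConjugate u (c ∷ r)
rotate-to-initial {_ ∷ []}    _    (s≤s ())
rotate-to-initial {x ∷ y ∷ t} circ len with initial? x
... | inj₁ ix = x , y ∷ t , ix , conjugate-refl _
... | inj₂ nx =
  y , t ∷ʳ x , nonInitial-⇢ nx (AlmostCircular-⇢ circ len (conjugate-refl _)) , [ x ] , y ∷ t , refl , refl

classify : ∀ n u → length u ≤ n → 2 ≤ length u → AlmostCircular u → ∃[ s ] Candidate s × IsConjugate s u
classify n       (a ∷ b ∷ [])          _   _ circ =
  classify-pair (AlmostFactor-⇝ (circ _ (conjugate-refl _)))
                (AlmostFactor-⇝ (circ _ ([ a ] , [ b ] , refl , refl)))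
classify (suc n) u@(_ ∷ _ ∷ _ ∷ _) len _ circ
  with c , r , ic , u~cr ← rotate-to-initial circ (s≤s (s≤s (s≤s z≤n)))
  with v , Fv≡ , shorter , v-long , v-circ ← AlmostCircular-desubstitute ic
         (subst (3 ≤_) (conjugate-length u~cr) (s≤s (s≤s (s≤s z≤n)))) (AlmostCircular-conjugate circ u~cr)
  with s , cand , s~v ← classify n v
         (≤-pred (≤-trans shorter (subst (_≤ suc n) (conjugate-length u~cr) len))) v-long v-circ
  = F s , Candidate-F cand (AlmostCircular-conjugate circ (conjugate-sym Fs~u)) , Fs~u
  where
  Fs~u : IsConjugate (F s) u
  Fs~u = conjugate-trans (subst (IsConjugate (F s)) Fv≡ (conjugate-F s~v)) (conjugate-sym u~cr)
classify zero    (_ ∷ _ ∷ _ ∷ _) () _ _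
classify _       []                _ () _
classify _       (_ ∷ [])          _ (s≤s ()) _

-- The words F^(3d+1)(0) and F^(3d+2)(0) are not circular

thrice : ℕ → ℕ
thrice zero    = zero
thrice (suc d) = suc (suc (suc (thrice d)))

iter-thrice : ∀ d w → iter (thrice d) F w ≡ iter d f w
iter-thrice zero    w = refl
iter-thrice (suc d) w = cong f (iter-thrice d w)

data Mod3 : ℕ → Set where
  0-mod-3 : ∀ d → Mod3 (thrice d)
  1-mod-3 : ∀ d → Mod3 (suc (thrice d))
  2-mod-3 : ∀ d → Mod3 (suc (suc (thrice d)))

mod3 : ∀ n → Mod3 n
mod3 zero = 0-mod-3 zero
mod3 (suc n) with mod3 n
... | 0-mod-3 d = 1-mod-3 d
... | 1-mod-3 d = 2-mod-3 d
... | 2-mod-3 d = 0-mod-3 (suc d)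

-- F^(3d+1)(0) = front d ++ back d, cut just before its last letter 1.
front : ℕ → Word
front zero    = l0 ∷ []
front (suc d) = f (front d) ∷ʳ l0

back′ : ℕ → Word
back′ zero    = []
back′ (suc d) = l2 ∷ l4 ∷ f (back′ d)

back : ℕ → Word
back d = l1 ∷ back′ d

F^0-front-back : ∀ d → F^[ suc (thrice d) ]0 ≡ front d ++ back d
F^0-front-back zero    = refl
F^0-front-back (suc d) = begin
  f F^[ suc (thrice d) ]0          ≡⟨ cong f (F^0-front-back d) ⟩
  f (front d ++ back d)            ≡⟨ f-++ (front d) (back d) ⟩
  f (front d) ++ f (back d)        ≡⟨ ++-assoc (f (front d)) [ l0 ] (back (suc d)) ⟨
  front (suc d) ++ back (suc d)    ∎
  where open ≡-Reasoning

front-∷ʳ : ∀ d → ∃[ q ] front d ≡ q ∷ʳ l0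
front-∷ʳ zero    = [] , refl
front-∷ʳ (suc d) = f (front d) , refl

Factor-F²⁻¹ : ∀ w → Factor (F (F w) ++ [ l0 ]) → Factor w
Factor-F²⁻¹ w fa with Factor-F⁻¹ (F w) [] i0 fa
... | l0 , _ , fy = Factor-F⁻¹-cut w [] i0 fy
... | l2 , _ , fy = Factor-F⁻¹-cut w [] i2 fy

0-back-front : ∀ d → l0 ∷ back (suc d) ++ front (suc d) ≡ f (back d ++ front d) ++ [ l0 ]
0-back-front d = begin
  f (back d) ++ f (front d) ++ [ l0 ]   ≡⟨ ++-assoc (f (back d)) (f (front d)) [ l0 ] ⟨
  (f (back d) ++ f (front d)) ++ [ l0 ] ≡⟨ cong (_++ [ l0 ]) (f-++ (back d) (front d)) ⟨
  f (back d ++ front d) ++ [ l0 ]       ∎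
  where open ≡-Reasoning

mutual
  ¬Factor-back-front : ∀ d → ¬ Factor (back d ++ front d)
  ¬Factor-back-front zero fa with () ← Factor-⇢ fa
  ¬Factor-back-front (suc d) fa with Factor-extendˡ n1 fa
  ... | l0 , 0⇢1 , fa′ =
    ¬Factor-F-back-front d (Factor-F²⁻¹ (F (back d ++ front d)) (subst Factor (0-back-front d) fa′))

  ¬Factor-F-back-front : ∀ d → ¬ Factor (F (back d ++ front d))
  ¬Factor-F-back-front d fa with q , front≡ ← front-∷ʳ d =
    ¬Factor-back-front d
      (subst Factor (sym w≡) (Factor-F⁻¹-∷ʳ (back d ++ q) l0 (λ ()) (subst (λ w → Factor (F w)) w≡ fa)))
    where
    w≡ : back d ++ front d ≡ (back d ++ q) ∷ʳ l0
    w≡ = trans (cong (back d ++_) front≡) (sym (++-assoc (back d) q [ l0 ]))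

Candidate-InC : ∀ {s} → Candidate s → (∀ v → IsConjugate s v → Factor v) → InC s
Candidate-InC one-two      circ with () ← Factor-⇢ (circ _ ([ l1 ] , [ l2 ] , refl , refl))
Candidate-InC F-two        _    = inj₁ refl
Candidate-InC F²-two       _    = inj₂ (inj₁ refl)
Candidate-InC (Fⁿ-four {n} n≥1) _ = inj₂ (inj₂ (inj₁ (n , n≥1 , refl)))
Candidate-InC (Fⁿ-zero {n} n≥1) circ with mod3 n
Candidate-InC (Fⁿ-zero ()) circ | 0-mod-3 zero
... | 0-mod-3 (suc d) = inj₂ (inj₂ (inj₂ (suc d , s≤s z≤n , iter-thrice (suc d) (l0 ∷ []))))
... | 1-mod-3 d = ⊥-elim (¬Factor-back-front d (circ _ (front d , back d , F^0-front-back d , refl)))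
... | 2-mod-3 d = ⊥-elim (¬Factor-F-back-front d (circ _ (F (front d) , F (back d) ,
                    trans (cong F (F^0-front-back d)) (F-++ (front d) (back d)) , F-++ (back d) (front d))))

-- Factors of Fω as positions

F^0-prefix : ∀ {m n} → m ≤ n → ∃[ t ] F^[ n ]0 ≡ F^[ m ]0 ++ t
F^0-prefix {m} {n} m≤n = go (≤⇒≤′ m≤n)
  where
  go : ∀ {n} → m ≤′ n → ∃[ t ] F^[ n ]0 ≡ F^[ m ]0 ++ t
  go ≤′-refl = [] , sym (++-identityʳ F^[ m ]0)
  go (≤′-step {n} m≤n) with t , eq ← go m≤n | d , t′ , eq′ ← F^0-grows n =
    t ++ d ∷ t′ , trans eq′ (trans (cong (_++ d ∷ t′) eq) (++-assoc F^[ m ]0 t (d ∷ t′)))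

F^0-length : ∀ m → m < length F^[ m ]0
F^0-length zero    = s≤s z≤n
F^0-length (suc m) with d , t , eq ← F^0-grows m = begin-strict
  suc m                          <⟨ s≤s (F^0-length m) ⟩
  suc (length F^[ m ]0)          ≤⟨ s≤s (length-++-≤ˡ F^[ m ]0) ⟩
  suc (length (F^[ m ]0 ++ t))   ≡⟨ length-++-sucʳ F^[ m ]0 d t ⟨
  length (F^[ m ]0 ++ d ∷ t)     ≡⟨ cong length eq ⟨
  length F^[ suc m ]0            ∎
  where open ≤-Reasoning

nth-++ : ∀ a t {k} → k < length a → nth (a ++ t) k ≡ nth a k
nth-++ (x ∷ a) t {zero}  _         = refl
nth-++ (x ∷ a) t {suc k} (s≤s k<) = nth-++ a t k<

nth-F^0 : ∀ {k m} → k ≤ m → nth F^[ m ]0 k ≡ Fω k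
nth-F^0 {k} k≤m with t , eq ← F^0-prefix k≤m =
  trans (cong (λ w → nth w k) eq) (nth-++ F^[ k ]0 t (F^0-length k))

nth-lookup : ∀ (w : Word) j → nth w (toℕ j) ≡ lookup w j
nth-lookup (x ∷ w) zero    = refl
nth-lookup (x ∷ w) (suc j) = nth-lookup w j

prefix-by-nth : ∀ L w → length w ≤ length L → (∀ j → j < length w → nth L j ≡ nth w j) → ∃[ b ] L ≡ w ++ b
prefix-by-nth L       []      _         _  = L , refl
prefix-by-nth (x ∷ L) (c ∷ w) (s≤s le) eq with refl ← eq zero (s≤s z≤n)
  with b , L≡ ← prefix-by-nth L w le (λ j j< → eq (suc j) (s≤s j<)) = b , cong (x ∷_) L≡

infix-by-nth : ∀ L i w → i + length w ≤ length L → (∀ j → j < length w → nth L (i + j) ≡ nth w j) →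
  ∃₂ λ a b → L ≡ a ++ w ++ b
infix-by-nth L       zero    w le eq with b , L≡ ← prefix-by-nth L w le eq = [] , b , L≡
infix-by-nth (x ∷ L) (suc i) w (s≤s le) eq
  with a , b , L≡ ← infix-by-nth L i w le eq = x ∷ a , b , cong (x ∷_) L≡

occurrence-nth : ∀ w i → (∀ (j : Fin (length w)) → Fω (i + toℕ j) ≡ lookup w j) →
  ∀ m j → i + length w ≤ m → j < length w → nth F^[ m ]0 (i + j) ≡ nth w j
occurrence-nth w i occ m j i+w≤m j< = begin
  nth F^[ m ]0 (i + j)              ≡⟨ nth-F^0 (≤-trans (+-monoʳ-≤ i (<⇒≤ j<)) i+w≤m) ⟩
  Fω (i + j)                        ≡⟨ cong (λ k → Fω (i + k)) (toℕ-fromℕ< j<) ⟨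
  Fω (i + toℕ (fromℕ< j<))          ≡⟨ occ (fromℕ< j<) ⟩
  lookup w (fromℕ< j<)              ≡⟨ nth-lookup w (fromℕ< j<) ⟨
  nth w (toℕ (fromℕ< j<))           ≡⟨ cong (nth w) (toℕ-fromℕ< j<) ⟩
  nth w j                           ∎
  where open ≡-Reasoning

IsFactor⇒Factor : ∀ w → IsFactor w Fω → Factor w
IsFactor⇒Factor w (i , occ)
  with a , b , eq ← infix-by-nth F^[ i + length w ]0 i w (<⇒≤ (F^0-length _))
                      (λ j → occurrence-nth w i occ (i + length w) j ≤-refl)
  = occurs (i + length w) a b eq

mainTheorem2 : (u : Word) → length u ≥ 2
    → ((v : Word) → IsConjugate u v → IsFactor v Fω)
    → Σ Word (λ w → InC w × IsConjugate w u)
mainTheorem2 u len circ = conclude (classify (length u) u ≤-refl len (λ v u~v → factor (factor-of u~v)))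
  where
  factor-of : ∀ {v} → IsConjugate u v → Factor v
  factor-of {v} u~v = IsFactor⇒Factor v (circ v u~v)
  conclude : ∃[ s ] Candidate s × IsConjugate s u → Σ Word (λ w → InC w × IsConjugate w u)
  conclude (s , cand , s~u) =
    s , Candidate-InC cand (λ v s~v → factor-of (conjugate-trans (conjugate-sym s~u) s~v)) , s~u
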